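{- Let $q$ be an indeterminate. The infinite lower triangular matrices $P=\left((-1)^{i-j}q^{\binom{i-j}{2}}\begin{bmatrix}i+j\\ i-j\end{bmatrix}\right)_{i,j\ge0}$ and $Q=\left(C_{i-j}^{(2j+1)}(q)\right)_{i,j\ge0}$ are mutually inverse: $P^{ -1}=Q$.
   Context: $[a]=\frac{1-q^a}{1-q}$, $(q;q)_a=\prod_{l=1}^a(1-q^l)$, for integers $a\ge0$, $b$, $\begin{bmatrix}a\\ b\end{bmatrix}=\frac{(q;q)_a}{(q;q)_b(q;q)_{a-b}}$ if $0\le b\le a$ and $0$ otherwise; $\binom{a}{2}=a(a-1)/2$. For a positive integer $r$ and integer $\ell$, $C_\ell^{(r)}(q)=\frac{[r]}{[2\ell+r]}\begin{bmatrix}2\ell+r\\ \ell\end{bmatrix}$ for $\ell\ge0$ and $0$ for $\ell<0$. -}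

module Defs where

open import Data.Nat as ℕ using (ℕ; zero; suc; _∸_; _≤?_; _≟_)
open import Data.Nat.DivMod using (_/_)
open import Data.Integer as ℤ using (ℤ; +_; -[1+_])
open import Data.Fin using (toℕ)
open import Data.Vec as V using (Vec; []; _∷_)
open import Relation.Binary.PropositionalEquality using (_≡_)
open import Relation.Nullary using (yes; no)

-- Formal power series in the indeterminate q with integer coefficients:
-- a series is its coefficient sequence.  ℤ[q] embeds in ℤ[[q]], so all
-- polynomial identities may be checked there.
PS : Set
PS = ℕ → ℤ

infix 4 _≋_
_≋_ : PS → PS → Set
f ≋ g = ∀ n → f n ≡ g n

sumℤ : ℕ → (ℕ → ℤ) → ℤ
sumℤ zero    F = + 0
sumℤ (suc n) F = sumℤ n F ℤ.+ F n

zeroS : PS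
zeroS _ = + 0

oneS : PS
oneS zero    = + 1
oneS (suc _) = + 0

qS : PS
qS 1 = + 1
qS _ = + 0

infixl 6 _⊕_ _⊖_
infixl 7 _⊗_

_⊕_ : PS → PS → PS
(f ⊕ g) n = f n ℤ.+ g n

negS : PS → PS
negS f n = ℤ.- f n

_⊖_ : PS → PS → PS
f ⊖ g = f ⊕ negS g

_⊗_ : PS → PS → PS
(f ⊗ g) n = sumℤ (suc n) (λ k → f k ℤ.* g (n ∸ k))

powS : PS → ℕ → PS
powS f zero    = oneS
powS f (suc n) = powS f n ⊗ f

sumS : ℕ → (ℕ → PS) → PS
sumS zero    F = zeroS
sumS (suc n) F = sumS n F ⊕ F n

-- Multiplicative inverse of a series f with constant term 1
-- (all series inverted below have constant term 1):
-- c_0 = 1,  c_{n+1} = - Σ_{k=1}^{n+1} f_k c_{n+1-k}.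
-- invCoeffs f n = [c_n, c_{n-1}, …, c_0].
invCoeffs : PS → (n : ℕ) → Vec ℤ (suc n)
invCoeffs f zero    = + 1 ∷ []
invCoeffs f (suc n) =
  ℤ.- V.foldr _ ℤ._+_ (+ 0) (V.zipWith ℤ._*_ (V.tabulate {suc n} (λ i → f (suc (toℕ i))))
                              (invCoeffs f n))
  ∷ invCoeffs f n

invS : PS → PS
invS f n = V.head (invCoeffs f n)

qint : ℕ → PS
qint a = (oneS ⊖ powS qS a) ⊗ invS (oneS ⊖ qS)

qpoch : ℕ → PS
qpoch zero    = oneS
qpoch (suc a) = qpoch a ⊗ (oneS ⊖ powS qS (suc a))

qbin : ℕ → ℤ → PS
qbin a -[1+ _ ] = zeroS
qbin a (+ b) with b ≤? a
... | yes _ = qpoch a ⊗ invS (qpoch b ⊗ qpoch (a ∸ b))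
... | no  _ = zeroS

binom2 : ℕ → ℕ
binom2 a = (a ℕ.* (a ∸ 1)) / 2

signS : ℕ → PS
signS zero    = oneS
signS (suc a) = negS (signS a)

Cq : ℤ → ℕ → PS
Cq -[1+ _ ] r = zeroS
Cq (+ ℓ) r = qint r ⊗ invS (qint (2 ℕ.* ℓ ℕ.+ r)) ⊗ qbin (2 ℕ.* ℓ ℕ.+ r) (+ ℓ)

Mat : Set
Mat = ℕ → ℕ → PS

-- P_{ij} = (-1)^{i-j} q^{binom(i-j,2)} [i+j choose i-j]   (0 when j > i,
-- since then i-j < 0 and the q-binomial vanishes)
Pmat : Mat
Pmat i j with j ≤? i
... | yes _ = signS (i ∸ j) ⊗ powS qS (binom2 (i ∸ j)) ⊗ qbin (i ℕ.+ j) (+ (i ∸ j))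
... | no  _ = zeroS

Qmat : Mat
Qmat i j = Cq (+ i ℤ.- + j) (2 ℕ.* j ℕ.+ 1)

-- product of a lower-triangular matrix A with a matrix B:
-- (AB)_{ik} = Σ_j A_{ij} B_{jk} = Σ_{j ≤ i} A_{ij} B_{jk}  (A_{ij} = 0 for j > i)
_⊙_ : Mat → Mat → Mat
(A ⊙ B) i k = sumS (suc i) (λ j → A i j ⊗ B j k)

IdMat : Mat
IdMat i k with i ≟ k
... | yes _ = oneS
... | no  _ = zeroS

-- Everything is computed in ℤ[[q]]: series with constant term 1 (q-integers, q-Pochhammer
-- symbols) are invertible there, so each identity between q-binomial quotients can be checked
-- after clearing denominators. As Q is lower triangular, P Q is lower triangular with diagonal
-- entries P_ii Q_ii = 1. For i = k + m with m ≥ 1, multiplying (P Q)_{ik} by (q;q)_m turns the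
-- sum over j = k + t into (1 - q^{2k+1}) Σ_t (-1)^{m-t} q^{binom(m-t,2)} [m,t] g(t), where
-- g(t) = (q^{2k+t+2};q)_{m-1} is a polynomial of degree m - 1 in q^t. This m-th q-difference
-- annihilates every polynomial of degree < m in q^t, by induction on m using the q-Pascal rule.
-- Finally P is lower unitriangular, so P Q = I and P (Q P) = (P Q) P = P give Q P = I by
-- forward substitution.
module Submission where

open import Defs

open import Algebra.Bundles using (CommutativeRing; CommutativeMonoid)
open import Algebra.Structures using (IsCommutativeRing)
import Algebra.Solver.Ring.AlmostCommutativeRing as ACR
open import Data.Empty using (⊥-elim)
open import Data.Fin using (toℕ)
open import Data.Integer as ℤ using (ℤ; +_; -[1+_])
import Data.Integer.Properties as ℤₚ
open import Data.Maybe using (Maybe; just; nothing)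
open import Data.Nat as ℕ using (ℕ; zero; suc; _∸_; _<_; _≤_; _≤?_; _≟_; s≤s; z≤n)
open import Data.Nat.DivMod using (_/_; +-distrib-/-∣ʳ; m*n/n≡m)
open import Data.Nat.Divisibility using (divides)
open import Data.Nat.Induction using (<-rec)
import Data.Nat.Properties as ℕₚ
import Data.Nat.Tactic.RingSolver as ℕ-Solver
open import Data.Product using (_×_; _,_)
open import Data.Sum using (inj₁; inj₂)
open import Data.Vec as Vec using (_∷_)
open import Function using (_∘_)
open import Level using (0ℓ)
open import Relation.Binary.Definitions using (tri<; tri≈; tri>)
open import Relation.Binary.PropositionalEquality as ≡ using (_≡_; _≢_; cong; cong₂)
import Relation.Binary.Reasoning.Setoid
open import Relation.Nullary using (yes; no)

-- Finite sums

module FiniteSums {c ℓ} (R : CommutativeRing c ℓ) where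

  open CommutativeRing R hiding (zero)

  module Sum (sum : ℕ → (ℕ → Carrier) → Carrier)
             (sum-zero : ∀ F → sum zero F ≈ 0#)
             (sum-suc : ∀ n F → sum (suc n) F ≈ sum n F + F n) where

    open import Relation.Binary.Reasoning.Setoid setoid
    open import Algebra.Properties.CommutativeSemigroup
      (CommutativeMonoid.commutativeSemigroup +-commutativeMonoid) using (interchange)

    sum-cong : ∀ n {F G : ℕ → Carrier} → (∀ k → k < n → F k ≈ G k) → sum n F ≈ sum n G
    sum-cong zero    {F} {G} _   = trans (sum-zero F) (sym (sum-zero G))
    sum-cong (suc n) {F} {G} F≈G = begin
      sum (suc n) F  ≈⟨ sum-suc n F ⟩
      sum n F + F n  ≈⟨ +-cong (sum-cong n (λ k k<n → F≈G k (ℕₚ.m<n⇒m<1+n k<n))) (F≈G n ℕₚ.≤-refl) ⟩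
      sum n G + G n  ≈⟨ sum-suc n G ⟨
      sum (suc n) G  ∎

    sum-one : ∀ (F : ℕ → Carrier) → sum 1 F ≈ F 0
    sum-one F = trans (sum-suc 0 F) (trans (+-congʳ (sum-zero F)) (+-identityˡ (F 0)))

    sum-zeros : ∀ n {F : ℕ → Carrier} → (∀ k → k < n → F k ≈ 0#) → sum n F ≈ 0#
    sum-zeros zero    {F} _   = sum-zero F
    sum-zeros (suc n) {F} F≈0 = begin
      sum (suc n) F  ≈⟨ sum-suc n F ⟩
      sum n F + F n  ≈⟨ +-cong (sum-zeros n (λ k k<n → F≈0 k (ℕₚ.m<n⇒m<1+n k<n))) (F≈0 n ℕₚ.≤-refl) ⟩
      0# + 0#        ≈⟨ +-identityˡ 0# ⟩
      0#             ∎

    sum-+ : ∀ n (F G : ℕ → Carrier) → sum n (λ k → F k + G k) ≈ sum n F + sum n G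
    sum-+ zero F G = begin
      sum zero _               ≈⟨ sum-zero _ ⟩
      0#                       ≈⟨ +-identityˡ 0# ⟨
      0# + 0#                  ≈⟨ +-cong (sum-zero F) (sum-zero G) ⟨
      sum zero F + sum zero G  ∎
    sum-+ (suc n) F G = begin
      sum (suc n) (λ k → F k + G k)          ≈⟨ sum-suc n _ ⟩
      sum n (λ k → F k + G k) + (F n + G n)  ≈⟨ +-congʳ (sum-+ n F G) ⟩
      sum n F + sum n G + (F n + G n)        ≈⟨ interchange (sum n F) (sum n G) (F n) (G n) ⟩
      (sum n F + F n) + (sum n G + G n)      ≈⟨ +-cong (sum-suc n F) (sum-suc n G) ⟨
      sum (suc n) F + sum (suc n) G          ∎

    sum-*ˡ : ∀ n x (F : ℕ → Carrier) → x * sum n F ≈ sum n (λ k → x * F k)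
    sum-*ˡ zero x F = begin
      x * sum zero F  ≈⟨ *-congˡ (sum-zero F) ⟩
      x * 0#          ≈⟨ zeroʳ x ⟩
      0#              ≈⟨ sum-zero _ ⟨
      sum zero _      ∎
    sum-*ˡ (suc n) x F = begin
      x * sum (suc n) F                ≈⟨ *-congˡ (sum-suc n F) ⟩
      x * (sum n F + F n)              ≈⟨ distribˡ x (sum n F) (F n) ⟩
      x * sum n F + x * F n            ≈⟨ +-congʳ (sum-*ˡ n x F) ⟩
      sum n (λ k → x * F k) + x * F n  ≈⟨ sum-suc n _ ⟨
      sum (suc n) (λ k → x * F k)      ∎

    sum-*ʳ : ∀ n x (F : ℕ → Carrier) → sum n F * x ≈ sum n (λ k → F k * x)
    sum-*ʳ n x F = begin
      sum n F * x            ≈⟨ *-comm (sum n F) x ⟩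
      x * sum n F            ≈⟨ sum-*ˡ n x F ⟩
      sum n (λ k → x * F k)  ≈⟨ sum-cong n (λ k _ → *-comm x (F k)) ⟩
      sum n (λ k → F k * x)  ∎

    sum-head : ∀ n (F : ℕ → Carrier) → sum (suc n) F ≈ F 0 + sum n (F ∘ suc)
    sum-head zero F = begin
      sum 1 F                ≈⟨ sum-one F ⟩
      F 0                    ≈⟨ +-identityʳ (F 0) ⟨
      F 0 + 0#               ≈⟨ +-congˡ (sum-zero _) ⟨
      F 0 + sum 0 (F ∘ suc)  ∎
    sum-head (suc n) F = begin
      sum (suc (suc n)) F                  ≈⟨ sum-suc (suc n) F ⟩
      sum (suc n) F + F (suc n)            ≈⟨ +-congʳ (sum-head n F) ⟩
      F 0 + sum n (F ∘ suc) + F (suc n)    ≈⟨ +-assoc (F 0) _ _ ⟩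
      F 0 + (sum n (F ∘ suc) + F (suc n))  ≈⟨ +-congˡ (sum-suc n (F ∘ suc)) ⟨
      F 0 + sum (suc n) (F ∘ suc)          ∎

    sum-split : ∀ m n (F : ℕ → Carrier) → sum (m ℕ.+ n) F ≈ sum m F + sum n (λ k → F (m ℕ.+ k))
    sum-split m zero F = begin
      sum (m ℕ.+ 0) F    ≡⟨ ≡.cong (λ x → sum x F) (ℕₚ.+-identityʳ m) ⟩
      sum m F            ≈⟨ +-identityʳ (sum m F) ⟨
      sum m F + 0#       ≈⟨ +-congˡ (sum-zero _) ⟨
      sum m F + sum 0 _  ∎
    sum-split m (suc n) F = begin
      sum (m ℕ.+ suc n) F                                   ≡⟨ ≡.cong (λ x → sum x F) (ℕₚ.+-suc m n) ⟩
      sum (suc (m ℕ.+ n)) F                                 ≈⟨ sum-suc (m ℕ.+ n) F ⟩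
      sum (m ℕ.+ n) F + F (m ℕ.+ n)                         ≈⟨ +-congʳ (sum-split m n F) ⟩
      sum m F + sum n (λ k → F (m ℕ.+ k)) + F (m ℕ.+ n)     ≈⟨ +-assoc (sum m F) _ _ ⟩
      sum m F + (sum n (λ k → F (m ℕ.+ k)) + F (m ℕ.+ n))   ≈⟨ +-congˡ (sum-suc n _) ⟨
      sum m F + sum (suc n) (λ k → F (m ℕ.+ k))             ∎

    sum-swap : ∀ m n (F : ℕ → ℕ → Carrier) →
               sum m (λ j → sum n (F j)) ≈ sum n (λ l → sum m (λ j → F j l))
    sum-swap zero n F = begin
      sum zero _                ≈⟨ sum-zero _ ⟩
      0#                        ≈⟨ sum-zeros n (λ l _ → sum-zero _) ⟨
      sum n (λ l → sum zero _)  ∎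
    sum-swap (suc m) n F = begin
      sum (suc m) (λ j → sum n (F j))                  ≈⟨ sum-suc m _ ⟩
      sum m (λ j → sum n (F j)) + sum n (F m)          ≈⟨ +-congʳ (sum-swap m n F) ⟩
      sum n (λ l → sum m (λ j → F j l)) + sum n (F m)  ≈⟨ sum-+ n _ (F m) ⟨
      sum n (λ l → sum m (λ j → F j l) + F m l)        ≈⟨ sum-cong n (λ l _ → sym (sum-suc m _)) ⟩
      sum n (λ l → sum (suc m) (λ j → F j l))          ∎

    sum-reverse : ∀ n (F : ℕ → Carrier) → sum (suc n) F ≈ sum (suc n) (λ k → F (n ∸ k))
    sum-reverse zero    F = sum-cong 1 λ { _ (s≤s z≤n) → refl }
    sum-reverse (suc n) F = begin
      sum (suc (suc n)) F                        ≈⟨ sum-suc (suc n) F ⟩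
      sum (suc n) F + F (suc n)                  ≈⟨ +-congʳ (sum-reverse n F) ⟩
      sum (suc n) (λ k → F (n ∸ k)) + F (suc n)  ≈⟨ +-comm _ (F (suc n)) ⟩
      F (suc n) + sum (suc n) (λ k → F (n ∸ k))  ≈⟨ sum-head (suc n) (λ k → F (suc n ∸ k)) ⟨
      sum (suc (suc n)) (λ k → F (suc n ∸ k))    ∎

    sum-triangle : ∀ n (F : ℕ → ℕ → Carrier) →
      sum (suc n) (λ k → sum (suc k) (λ j → F j k)) ≈
      sum (suc n) (λ j → sum (suc (n ∸ j)) (λ l → F j (j ℕ.+ l)))
    sum-triangle zero    F = sum-cong 1 λ { _ (s≤s z≤n) → sum-cong 1 λ { _ (s≤s z≤n) → refl } }
    sum-triangle (suc n) F = begin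
      sum (suc (suc n)) (λ k → sum (suc k) (λ j → F j k))
        ≈⟨ sum-suc (suc n) _ ⟩
      sum (suc n) (λ k → sum (suc k) (λ j → F j k)) + sum (suc (suc n)) (λ j → F j (suc n))
        ≈⟨ +-cong (sum-triangle n F) (sum-suc (suc n) _) ⟩
      Rows n + (sum (suc n) (λ j → F j (suc n)) + F (suc n) (suc n))
        ≈⟨ +-assoc _ _ _ ⟨
      Rows n + sum (suc n) (λ j → F j (suc n)) + F (suc n) (suc n)
        ≈⟨ +-congʳ (sum-+ (suc n) _ _) ⟨
      sum (suc n) (λ j → Row n j + F j (suc n)) + F (suc n) (suc n)
        ≈⟨ +-cong (sum-cong (suc n) extendRow) lastRow ⟩
      sum (suc n) (Row (suc n)) + Row (suc n) (suc n)
        ≈⟨ sum-suc (suc n) _ ⟨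
      Rows (suc n)
        ∎
      where
      Row : ℕ → ℕ → Carrier
      Row m j = sum (suc (m ∸ j)) (λ l → F j (j ℕ.+ l))
      Rows : ℕ → Carrier
      Rows m = sum (suc m) (Row m)
      extendRow : ∀ j → j < suc n → Row n j + F j (suc n) ≈ Row (suc n) j
      extendRow j (s≤s j≤n) rewrite ℕₚ.+-∸-assoc 1 j≤n = begin
        Row n j + F j (suc n)                ≡⟨ cong (λ x → Row n j + F j x) j+[1+n∸j]≡1+n ⟨
        Row n j + F j (j ℕ.+ suc (n ∸ j))    ≈⟨ sum-suc (suc (n ∸ j)) _ ⟨
        sum (suc (suc (n ∸ j))) (λ l → F j (j ℕ.+ l)) ∎
        where
        j+[1+n∸j]≡1+n : j ℕ.+ suc (n ∸ j) ≡ suc n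
        j+[1+n∸j]≡1+n = ≡.trans (ℕₚ.+-suc j (n ∸ j)) (cong suc (ℕₚ.m+[n∸m]≡n j≤n))
      lastRow : F (suc n) (suc n) ≈ Row (suc n) (suc n)
      lastRow rewrite ℕₚ.n∸n≡0 n = sym (trans (sum-one _) (reflexive (cong (F (suc n)) (ℕₚ.+-identityʳ (suc n)))))

-- Power series

module ℤΣ = FiniteSums.Sum ℤₚ.+-*-commutativeRing sumℤ (λ _ → ≡.refl) (λ _ _ → ≡.refl)

⊗-identityˡ : ∀ f → oneS ⊗ f ≋ f
⊗-identityˡ f n = begin
  sumℤ (suc n) (λ k → oneS k ℤ.* f (n ∸ k))
    ≡⟨ ℤΣ.sum-head n _ ⟩
  + 1 ℤ.* f n ℤ.+ sumℤ n (λ k → + 0 ℤ.* f (n ∸ suc k))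
    ≡⟨ cong₂ ℤ._+_ (ℤₚ.*-identityˡ (f n)) (ℤΣ.sum-zeros n (λ k _ → ℤₚ.*-zeroˡ (f (n ∸ suc k)))) ⟩
  f n ℤ.+ + 0
    ≡⟨ ℤₚ.+-identityʳ (f n) ⟩
  f n
    ∎
  where open ≡.≡-Reasoning

⊗-comm : ∀ f g → f ⊗ g ≋ g ⊗ f
⊗-comm f g n = begin
  sumℤ (suc n) (λ k → f k ℤ.* g (n ∸ k))              ≡⟨ ℤΣ.sum-reverse n _ ⟩
  sumℤ (suc n) (λ k → f (n ∸ k) ℤ.* g (n ∸ (n ∸ k)))  ≡⟨ ℤΣ.sum-cong (suc n) swap ⟩
  sumℤ (suc n) (λ k → g k ℤ.* f (n ∸ k))              ∎
  where
  open ≡.≡-Reasoning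
  swap : ∀ k → k < suc n → f (n ∸ k) ℤ.* g (n ∸ (n ∸ k)) ≡ g k ℤ.* f (n ∸ k)
  swap k (s≤s k≤n) rewrite ℕₚ.m∸[m∸n]≡n k≤n = ℤₚ.*-comm (f (n ∸ k)) (g k)

⊗-identityʳ : ∀ f → f ⊗ oneS ≋ f
⊗-identityʳ f n = ≡.trans (⊗-comm f oneS n) (⊗-identityˡ f n)

⊗-assoc : ∀ f g h → (f ⊗ g) ⊗ h ≋ f ⊗ (g ⊗ h)
⊗-assoc f g h n = begin
  sumℤ (suc n) (λ k → sumℤ (suc k) (λ j → f j ℤ.* g (k ∸ j)) ℤ.* h (n ∸ k))
    ≡⟨ ℤΣ.sum-cong (suc n) (λ k _ → ℤΣ.sum-*ʳ (suc k) _ _) ⟩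
  sumℤ (suc n) (λ k → sumℤ (suc k) (λ j → f j ℤ.* g (k ∸ j) ℤ.* h (n ∸ k)))
    ≡⟨ ℤΣ.sum-triangle n _ ⟩
  sumℤ (suc n) (λ j → sumℤ (suc (n ∸ j)) (λ l → f j ℤ.* g (j ℕ.+ l ∸ j) ℤ.* h (n ∸ (j ℕ.+ l))))
    ≡⟨ ℤΣ.sum-cong (suc n) (λ j _ → ℤΣ.sum-cong (suc (n ∸ j)) (λ l _ → reindex j l)) ⟩
  sumℤ (suc n) (λ j → sumℤ (suc (n ∸ j)) (λ l → f j ℤ.* (g l ℤ.* h (n ∸ j ∸ l))))
    ≡⟨ ℤΣ.sum-cong (suc n) (λ j _ → ℤΣ.sum-*ˡ (suc (n ∸ j)) (f j) _) ⟨
  sumℤ (suc n) (λ j → f j ℤ.* sumℤ (suc (n ∸ j)) (λ l → g l ℤ.* h (n ∸ j ∸ l)))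
    ∎
  where
  open ≡.≡-Reasoning
  reindex : ∀ j l → f j ℤ.* g (j ℕ.+ l ∸ j) ℤ.* h (n ∸ (j ℕ.+ l)) ≡ f j ℤ.* (g l ℤ.* h (n ∸ j ∸ l))
  reindex j l rewrite ℕₚ.m+n∸m≡n j l | ℕₚ.∸-+-assoc n j l = ℤₚ.*-assoc (f j) (g l) _

⊗-distribˡ : ∀ f g h → f ⊗ (g ⊕ h) ≋ f ⊗ g ⊕ f ⊗ h
⊗-distribˡ f g h n =
  ≡.trans (ℤΣ.sum-cong (suc n) (λ k _ → ℤₚ.*-distribˡ-+ (f k) _ _)) (ℤΣ.sum-+ (suc n) _ _)

⊗-distribʳ : ∀ f g h → (g ⊕ h) ⊗ f ≋ g ⊗ f ⊕ h ⊗ f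
⊗-distribʳ f g h n = ≡.trans (⊗-comm (g ⊕ h) f n)
  (≡.trans (⊗-distribˡ f g h n) (cong₂ ℤ._+_ (⊗-comm f g n) (⊗-comm f h n)))

-- Wrapping ≋ in a record makes both series inferable from an equality proof.
infix 4 _≈_
record _≈_ (f g : PS) : Set where
  constructor wrap
  field unwrap : f ≋ g
open _≈_

psIsCommutativeRing : IsCommutativeRing _≈_ _⊕_ _⊗_ negS zeroS oneS
psIsCommutativeRing = record
  { isRing = record
    { +-isAbelianGroup = record
      { isGroup = record
        { isMonoid = record
          { isSemigroup = record
            { isMagma = record
              { isEquivalence = record
                { refl  = wrap (λ _ → ≡.refl)
                ; sym   = λ p → wrap (≡.sym ∘ unwrap p)
                ; trans = λ p q → wrap (λ n → ≡.trans (unwrap p n) (unwrap q n)) }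
              ; ∙-cong = λ p q → wrap (λ n → cong₂ ℤ._+_ (unwrap p n) (unwrap q n)) }
            ; assoc = λ f g h → wrap (λ n → ℤₚ.+-assoc (f n) (g n) (h n)) }
          ; identity = (λ f → wrap (ℤₚ.+-identityˡ ∘ f)) , (λ f → wrap (ℤₚ.+-identityʳ ∘ f)) }
        ; inverse = (λ f → wrap (ℤₚ.+-inverseˡ ∘ f)) , (λ f → wrap (ℤₚ.+-inverseʳ ∘ f))
        ; ⁻¹-cong = λ p → wrap (cong ℤ.-_ ∘ unwrap p) }
      ; comm = λ f g → wrap (λ n → ℤₚ.+-comm (f n) (g n)) }
    ; *-cong = λ p q → wrap (λ n → ℤΣ.sum-cong (suc n) (λ k _ → cong₂ ℤ._*_ (unwrap p k) (unwrap q (n ∸ k))))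
    ; *-assoc = λ f g h → wrap (⊗-assoc f g h)
    ; *-identity = (λ f → wrap (⊗-identityˡ f)) , (λ f → wrap (⊗-identityʳ f))
    ; distrib = (λ f g h → wrap (⊗-distribˡ f g h)) , (λ f g h → wrap (⊗-distribʳ f g h)) }
  ; *-comm = λ f g → wrap (⊗-comm f g) }

psCommutativeRing : CommutativeRing 0ℓ 0ℓ
psCommutativeRing = record { isCommutativeRing = psIsCommutativeRing }

open CommutativeRing psCommutativeRing
  using (setoid; refl; sym; trans; reflexive; +-cong; *-cong; -‿cong
        ; +-identityˡ; +-identityʳ; +-assoc; *-identityˡ; *-identityʳ; *-assoc; *-comm
        ; zeroˡ; zeroʳ; *-commutativeMonoid)

module ≈-Reasoning = Relation.Binary.Reasoning.Setoid setoid

-- The fixed factor is explicit: _⊗_ is not injective, so it cannot be inferred.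
⊗-congˡ : ∀ x {y z} → y ≈ z → x ⊗ y ≈ x ⊗ z
⊗-congˡ x = *-cong (refl {x})

⊗-congʳ : ∀ z {x y} → x ≈ y → x ⊗ z ≈ y ⊗ z
⊗-congʳ z x≈y = *-cong x≈y (refl {z})

⊕-congˡ : ∀ x {y z} → y ≈ z → x ⊕ y ≈ x ⊕ z
⊕-congˡ x = +-cong (refl {x})

⊕-congʳ : ∀ z {x y} → x ≈ y → x ⊕ z ≈ y ⊕ z
⊕-congʳ z x≈y = +-cong x≈y (refl {z})

open FiniteSums.Sum psCommutativeRing sumS (λ _ → refl) (λ _ _ → refl)

open import Algebra.Properties.CommutativeSemigroup
  (CommutativeMonoid.commutativeSemigroup *-commutativeMonoid) using (interchange; xy∙z≈xz∙y)
open import Algebra.Properties.Group (CommutativeRing.+-group psCommutativeRing) using (∙-cancelˡ)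

constant : ℤ → PS
constant c zero    = c
constant c (suc _) = + 0

-- 0 and 1 are sent to zeroS and oneS themselves, so that the solver's constants match
-- the goals definitionally.
constS : ℤ → PS
constS (+ 0) = zeroS
constS (+ 1) = oneS
constS c     = constant c

constS≈constant : ∀ c → constS c ≈ constant c
constS≈constant (+ 0)           = wrap λ { zero → ≡.refl ; (suc _) → ≡.refl }
constS≈constant (+ 1)           = wrap λ { zero → ≡.refl ; (suc _) → ≡.refl }
constS≈constant (+ suc (suc _)) = refl
constS≈constant -[1+ _ ]        = refl

constant-+ : ∀ a b → constant (a ℤ.+ b) ≈ constant a ⊕ constant b
constant-+ a b = wrap λ { zero → ≡.refl ; (suc _) → ≡.refl }

constant-* : ∀ a b → constant (a ℤ.* b) ≈ constant a ⊗ constant b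
constant-* a b = wrap λ
  { zero    → ≡.sym (ℤₚ.+-identityˡ (a ℤ.* b))
  ; (suc n) → ≡.sym (≡.trans (ℤΣ.sum-head (suc n) _)
      (cong₂ ℤ._+_ (ℤₚ.*-zeroʳ a) (ℤΣ.sum-zeros (suc n) (λ k _ → ℤₚ.*-zeroˡ (constant b (n ∸ k)))))) }

constant-neg : ∀ a → constant (ℤ.- a) ≈ negS (constant a)
constant-neg a = wrap λ { zero → ≡.refl ; (suc _) → ≡.refl }

constS-morphism : ℤ.+-*-rawRing ACR.-Raw-AlmostCommutative⟶ ACR.fromCommutativeRing psCommutativeRing
constS-morphism = record
  { ⟦_⟧    = constS
  ; +-homo = λ a b → trans (constS≈constant (a ℤ.+ b))
                       (trans (constant-+ a b) (sym (+-cong (constS≈constant a) (constS≈constant b))))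
  ; *-homo = λ a b → trans (constS≈constant (a ℤ.* b))
                       (trans (constant-* a b) (sym (*-cong (constS≈constant a) (constS≈constant b))))
  ; -‿homo = λ a → trans (constS≈constant (ℤ.- a)) (trans (constant-neg a) (sym (-‿cong (constS≈constant a))))
  ; 0-homo = refl
  ; 1-homo = refl }

constS-≟ : ∀ a b → Maybe (constS a ≈ constS b)
constS-≟ a b with a ℤ.≟ b
... | yes ≡.refl = just refl
... | no _       = nothing

open import Algebra.Solver.Ring ℤ.+-*-rawRing (ACR.fromCommutativeRing psCommutativeRing) constS-morphism constS-≟
  using (solve; _:=_; _:+_; _:*_; :-_; _:-_; con)

record ConstantTermOne (f : PS) : Set where
  constructor constantTermOne
  field constantTerm : f 0 ≡ + 1

⊗-constantTermOne : ∀ {f g} → ConstantTermOne f → ConstantTermOne g → ConstantTermOne (f ⊗ g)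
⊗-constantTermOne (constantTermOne f₀) (constantTermOne g₀) =
  constantTermOne (cong₂ (λ a b → + 0 ℤ.+ a ℤ.* b) f₀ g₀)

invCoeffs-tabulate : ∀ f n → invCoeffs f n ≡ Vec.tabulate (λ i → invS f (n ∸ toℕ i))
invCoeffs-tabulate f zero    = ≡.refl
invCoeffs-tabulate f (suc n) = cong (invS f (suc n) ∷_) (invCoeffs-tabulate f n)

foldr-zipWith-tabulate : ∀ n (a b : ℕ → ℤ) →
  Vec.foldr _ ℤ._+_ (+ 0) (Vec.zipWith ℤ._*_ (Vec.tabulate {n} (a ∘ toℕ)) (Vec.tabulate (b ∘ toℕ)))
  ≡ sumℤ n (λ i → a i ℤ.* b i)
foldr-zipWith-tabulate zero    a b = ≡.refl
foldr-zipWith-tabulate (suc n) a b =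
  ≡.trans (cong (ℤ._+_ (a 0 ℤ.* b 0)) (foldr-zipWith-tabulate n (a ∘ suc) (b ∘ suc)))
          (≡.sym (ℤΣ.sum-head n _))

invS-suc : ∀ f n → invS f (suc n) ≡ ℤ.- sumℤ (suc n) (λ i → f (suc i) ℤ.* invS f (n ∸ i))
invS-suc f n = cong ℤ.-_ (≡.trans
  (cong (Vec.foldr _ ℤ._+_ (+ 0) ∘ Vec.zipWith ℤ._*_ (Vec.tabulate (f ∘ suc ∘ toℕ))) (invCoeffs-tabulate f n))
  (foldr-zipWith-tabulate (suc n) (f ∘ suc) (λ i → invS f (n ∸ i))))

invS-inverseʳ : ∀ {f} → ConstantTermOne f → f ⊗ invS f ≈ oneS
invS-inverseʳ {f} (constantTermOne f₀) = wrap coefficient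
  where
  open ≡.≡-Reasoning
  coefficient : ∀ n → (f ⊗ invS f) n ≡ oneS n
  coefficient zero rewrite f₀ = ≡.refl
  coefficient (suc n) = begin
    sumℤ (suc (suc n)) (λ k → f k ℤ.* invS f (suc n ∸ k))  ≡⟨ ℤΣ.sum-head (suc n) _ ⟩
    f 0 ℤ.* invS f (suc n) ℤ.+ S                          ≡⟨ cong (λ c → c ℤ.* invS f (suc n) ℤ.+ S) f₀ ⟩
    + 1 ℤ.* invS f (suc n) ℤ.+ S                          ≡⟨ cong (ℤ._+ S) (ℤₚ.*-identityˡ (invS f (suc n))) ⟩
    invS f (suc n) ℤ.+ S                                  ≡⟨ cong (ℤ._+ S) (invS-suc f n) ⟩
    ℤ.- S ℤ.+ S                                           ≡⟨ ℤₚ.+-inverseˡ S ⟩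
    + 0                                                   ∎
    where S = sumℤ (suc n) (λ i → f (suc i) ℤ.* invS f (n ∸ i))

invS-cancelʳ : ∀ {u} → ConstantTermOne u → ∀ x → x ⊗ invS u ⊗ u ≈ x
invS-cancelʳ {u} u₀ x = begin
  x ⊗ invS u ⊗ u    ≈⟨ *-assoc x (invS u) u ⟩
  x ⊗ (invS u ⊗ u)  ≈⟨ ⊗-congˡ x (trans (*-comm (invS u) u) (invS-inverseʳ u₀)) ⟩
  x ⊗ oneS          ≈⟨ *-identityʳ x ⟩
  x                 ∎
  where open ≈-Reasoning

cancelʳ : ∀ {x y u} → ConstantTermOne u → x ⊗ u ≈ y ⊗ u → x ≈ y
cancelʳ {x} {y} {u} u₀ eq = begin
  x               ≈⟨ invS-cancelʳ u₀ x ⟨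
  x ⊗ invS u ⊗ u  ≈⟨ xy∙z≈xz∙y x (invS u) u ⟩
  x ⊗ u ⊗ invS u  ≈⟨ ⊗-congʳ (invS u) eq ⟩
  y ⊗ u ⊗ invS u  ≈⟨ xy∙z≈xz∙y y u (invS u) ⟩
  y ⊗ invS u ⊗ u  ≈⟨ invS-cancelʳ u₀ y ⟩
  y               ∎
  where open ≈-Reasoning

-- q-analogues

q^ : ℕ → PS
q^ = powS qS

powS-+ : ∀ f m n → powS f (m ℕ.+ n) ≈ powS f m ⊗ powS f n
powS-+ f zero    n = sym (*-identityˡ (powS f n))
powS-+ f (suc m) n = begin
  powS f (m ℕ.+ n) ⊗ f     ≈⟨ ⊗-congʳ f (powS-+ f m n) ⟩
  powS f m ⊗ powS f n ⊗ f  ≈⟨ xy∙z≈xz∙y (powS f m) (powS f n) f ⟩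
  powS f m ⊗ f ⊗ powS f n  ∎
  where open ≈-Reasoning

constantTermOne-1 : ConstantTermOne oneS
constantTermOne-1 = constantTermOne ≡.refl

constantTermOne-1-q : ConstantTermOne (oneS ⊖ qS)
constantTermOne-1-q = constantTermOne ≡.refl

constantTermOne-1-q^ : ∀ n → ConstantTermOne (oneS ⊖ q^ (suc n))
constantTermOne-1-q^ n =
  constantTermOne (cong (λ c → + 1 ℤ.+ ℤ.- c) (≡.trans (ℤₚ.+-identityˡ _) (ℤₚ.*-zeroʳ (q^ n 0))))

constantTermOne-invS : ∀ f → ConstantTermOne (invS f)
constantTermOne-invS f = constantTermOne ≡.refl

constantTermOne-qpoch : ∀ a → ConstantTermOne (qpoch a)
constantTermOne-qpoch zero    = constantTermOne-1
constantTermOne-qpoch (suc a) = ⊗-constantTermOne (constantTermOne-qpoch a) (constantTermOne-1-q^ a)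

constantTermOne-qint : ∀ n → ConstantTermOne (qint (suc n))
constantTermOne-qint n = ⊗-constantTermOne (constantTermOne-1-q^ n) (constantTermOne-invS (oneS ⊖ qS))

qint-*-1-q : ∀ a → qint a ⊗ (oneS ⊖ qS) ≈ oneS ⊖ q^ a
qint-*-1-q a = invS-cancelʳ constantTermOne-1-q (oneS ⊖ q^ a)

qbin-≤ : ∀ {a b} → b ≤ a → qbin a (+ b) ≡ qpoch a ⊗ invS (qpoch b ⊗ qpoch (a ∸ b))
qbin-≤ {a} {b} b≤a with b ≤? a
... | yes _   = ≡.refl
... | no b≰a = ⊥-elim (b≰a b≤a)

qbin-> : ∀ {a b} → a < b → qbin a (+ b) ≡ zeroS
qbin-> {a} {b} a<b with b ≤? a
... | yes b≤a = ⊥-elim (ℕₚ.<⇒≱ a<b b≤a)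
... | no _    = ≡.refl

qbin-cleared : ∀ b c → qbin (b ℕ.+ c) (+ b) ⊗ (qpoch b ⊗ qpoch c) ≈ qpoch (b ℕ.+ c)
qbin-cleared b c rewrite qbin-≤ (ℕₚ.m≤m+n b c) | ℕₚ.m+n∸m≡n b c =
  invS-cancelʳ (⊗-constantTermOne (constantTermOne-qpoch b) (constantTermOne-qpoch c)) (qpoch (b ℕ.+ c))

qbin-zero : ∀ a → qbin a (+ 0) ≈ oneS
qbin-zero a = cancelʳ (⊗-constantTermOne constantTermOne-1 (constantTermOne-qpoch a)) (begin
  qbin a (+ 0) ⊗ (qpoch 0 ⊗ qpoch a)  ≈⟨ qbin-cleared 0 a ⟩
  qpoch a                             ≈⟨ *-identityˡ (qpoch a) ⟨
  oneS ⊗ qpoch a                      ≈⟨ *-identityˡ (oneS ⊗ qpoch a) ⟨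
  oneS ⊗ (qpoch 0 ⊗ qpoch a)          ∎)
  where open ≈-Reasoning

qbin-diag : ∀ a → qbin a (+ a) ≈ oneS
qbin-diag a = cancelʳ (⊗-constantTermOne (constantTermOne-qpoch a) constantTermOne-1) (begin
  qbin a (+ a) ⊗ (qpoch a ⊗ qpoch 0)          ≡⟨ cong (λ n → qbin n (+ a) ⊗ (qpoch a ⊗ qpoch 0)) (ℕₚ.+-identityʳ a) ⟨
  qbin (a ℕ.+ 0) (+ a) ⊗ (qpoch a ⊗ qpoch 0)  ≈⟨ qbin-cleared a 0 ⟩
  qpoch (a ℕ.+ 0)                             ≡⟨ cong qpoch (ℕₚ.+-identityʳ a) ⟩
  qpoch a                                     ≈⟨ *-identityʳ (qpoch a) ⟨
  qpoch a ⊗ oneS                              ≈⟨ *-identityˡ (qpoch a ⊗ oneS) ⟨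
  oneS ⊗ (qpoch a ⊗ qpoch 0)                  ∎)
  where open ≈-Reasoning

-- Multiplied out by (q;q)_{s+1} (q;q)_{r+1}, the rule becomes
-- (1 - q^{s+1}) + q^{s+1} (1 - q^{r+1}) = 1 - q^{s+r+2}.
qbin-pascal-interior : ∀ s r → let m = s ℕ.+ suc r in
  qbin (suc m) (+ suc s) ≈ qbin m (+ s) ⊕ q^ (suc s) ⊗ qbin m (+ suc s)
qbin-pascal-interior s r = cancelʳ (⊗-constantTermOne (constantTermOne-qpoch (suc s)) (constantTermOne-qpoch (suc r))) (begin
  qbin (suc m) (+ suc s) ⊗ (qpoch (suc s) ⊗ qpoch (suc r))
    ≈⟨ qbin-cleared (suc s) (suc r) ⟩
  qpoch m ⊗ (oneS ⊖ q^ (suc s ℕ.+ suc r))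
    ≈⟨ ⊗-congˡ (qpoch m) (⊕-congˡ oneS (-‿cong (powS-+ qS (suc s) (suc r)))) ⟩
  qpoch m ⊗ (oneS ⊖ a ⊗ b)
    ≈⟨ solve 3 (λ P a b → P :* (con (+ 1) :- a :* b) := P :* (con (+ 1) :- a) :+ a :* P :* (con (+ 1) :- b))
             refl (qpoch m) a b ⟩
  qpoch m ⊗ (oneS ⊖ a) ⊕ a ⊗ qpoch m ⊗ (oneS ⊖ b)
    ≈⟨ +-cong (⊗-congʳ (oneS ⊖ a) lower) (⊗-congʳ (oneS ⊖ b) (⊗-congˡ a upper)) ⟨
  G₁ ⊗ (qpoch s ⊗ qpoch (suc r)) ⊗ (oneS ⊖ a) ⊕ a ⊗ (G₂ ⊗ (qpoch (suc s) ⊗ qpoch r)) ⊗ (oneS ⊖ b)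
    ≈⟨ solve 6 (λ G₁ G₂ Ps Pr a b →
                  G₁ :* (Ps :* (Pr :* (con (+ 1) :- b))) :* (con (+ 1) :- a)
                    :+ a :* (G₂ :* (Ps :* (con (+ 1) :- a) :* Pr)) :* (con (+ 1) :- b)
                  := (G₁ :+ a :* G₂) :* (Ps :* (con (+ 1) :- a) :* (Pr :* (con (+ 1) :- b))))
             refl G₁ G₂ (qpoch s) (qpoch r) a b ⟩
  (G₁ ⊕ a ⊗ G₂) ⊗ (qpoch (suc s) ⊗ qpoch (suc r))
    ∎)
  where
  open ≈-Reasoning
  m = s ℕ.+ suc r
  a = q^ (suc s)
  b = q^ (suc r)
  G₁ = qbin m (+ s)
  G₂ = qbin m (+ suc s)
  lower : G₁ ⊗ (qpoch s ⊗ qpoch (suc r)) ≈ qpoch m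
  lower = qbin-cleared s (suc r)
  upper : G₂ ⊗ (qpoch (suc s) ⊗ qpoch r) ≈ qpoch m
  upper = ≡.subst (λ n → qbin n (+ suc s) ⊗ (qpoch (suc s) ⊗ qpoch r) ≈ qpoch n)
                  (≡.sym (ℕₚ.+-suc s r)) (qbin-cleared (suc s) r)

qbin-pascal : ∀ m t → qbin (suc m) (+ t) ≈ qbin m (ℤ.pred (+ t)) ⊕ q^ t ⊗ qbin m (+ t)
qbin-pascal m zero = begin
  qbin (suc m) (+ 0)           ≈⟨ qbin-zero (suc m) ⟩
  oneS                         ≈⟨ qbin-zero m ⟨
  qbin m (+ 0)                 ≈⟨ *-identityˡ _ ⟨
  oneS ⊗ qbin m (+ 0)          ≈⟨ +-identityˡ _ ⟨
  zeroS ⊕ oneS ⊗ qbin m (+ 0)  ∎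
  where open ≈-Reasoning
qbin-pascal m (suc s) with ℕₚ.<-cmp s m
... | tri< s<m _ _ =
  ≡.subst (λ n → qbin (suc n) (+ suc s) ≈ qbin n (+ s) ⊕ q^ (suc s) ⊗ qbin n (+ suc s))
          (≡.trans (ℕₚ.+-suc s (m ∸ suc s)) (ℕₚ.m+[n∸m]≡n s<m)) (qbin-pascal-interior s (m ∸ suc s))
... | tri≈ _ ≡.refl _ = begin
  qbin (suc s) (+ suc s)                        ≈⟨ qbin-diag (suc s) ⟩
  oneS                                          ≈⟨ qbin-diag s ⟨
  qbin s (+ s)                                  ≈⟨ +-identityʳ _ ⟨
  qbin s (+ s) ⊕ zeroS                          ≈⟨ ⊕-congˡ (qbin s (+ s)) (zeroʳ (q^ (suc s))) ⟨
  qbin s (+ s) ⊕ q^ (suc s) ⊗ zeroS             ≡⟨ cong (λ g → qbin s (+ s) ⊕ q^ (suc s) ⊗ g) (qbin-> (ℕₚ.n<1+n s)) ⟨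
  qbin s (+ s) ⊕ q^ (suc s) ⊗ qbin s (+ suc s)  ∎
  where open ≈-Reasoning
... | tri> _ _ m<s rewrite qbin-> (s≤s m<s) | qbin-> m<s | qbin-> (ℕₚ.m<n⇒m<1+n m<s) = begin
  zeroS                       ≈⟨ +-identityˡ zeroS ⟨
  zeroS ⊕ zeroS               ≈⟨ ⊕-congˡ zeroS (zeroʳ (q^ (suc s))) ⟨
  zeroS ⊕ q^ (suc s) ⊗ zeroS  ∎
  where open ≈-Reasoning

qpochFrom : ℕ → ℕ → PS
qpochFrom a zero    = oneS
qpochFrom a (suc s) = qpochFrom a s ⊗ (oneS ⊖ q^ (a ℕ.+ suc s))

qpoch-+ : ∀ a s → qpoch (a ℕ.+ s) ≈ qpoch a ⊗ qpochFrom a s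
qpoch-+ a zero rewrite ℕₚ.+-identityʳ a = sym (*-identityʳ (qpoch a))
qpoch-+ a (suc s) rewrite ℕₚ.+-suc a s =
  trans (⊗-congʳ (oneS ⊖ q^ (suc (a ℕ.+ s))) (qpoch-+ a s))
        (*-assoc (qpoch a) (qpochFrom a s) (oneS ⊖ q^ (suc (a ℕ.+ s))))

Cq-cleared : ∀ ℓ r →
  Cq (+ ℓ) (suc r) ⊗ (qpoch ℓ ⊗ qpoch (suc r ℕ.+ ℓ)) ≈ (oneS ⊖ q^ (suc r)) ⊗ qpoch (2 ℕ.* ℓ ℕ.+ r)
Cq-cleared ℓ r = begin
  X ⊗ I ⊗ B ⊗ U                      ≈⟨ *-assoc (X ⊗ I) B U ⟩
  X ⊗ I ⊗ (B ⊗ U)                    ≈⟨ ⊗-congˡ (X ⊗ I) binomial ⟩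
  X ⊗ I ⊗ (P ⊗ (oneS ⊖ q^ (suc n)))  ≈⟨ ⊗-congˡ (X ⊗ I) (⊗-congˡ P (sym (qint-*-1-q (suc n)))) ⟩
  X ⊗ I ⊗ (P ⊗ (qint (suc n) ⊗ O))
    ≈⟨ solve 5 (λ X I P N O → X :* I :* (P :* (N :* O)) := X :* O :* P :* (I :* N)) refl X I P (qint (suc n)) O ⟩
  X ⊗ O ⊗ P ⊗ (I ⊗ qint (suc n))     ≈⟨ *-cong (⊗-congʳ P (qint-*-1-q (suc r))) inverse ⟩
  (oneS ⊖ q^ (suc r)) ⊗ P ⊗ oneS     ≈⟨ *-identityʳ _ ⟩
  (oneS ⊖ q^ (suc r)) ⊗ P            ∎
  where
  open ≈-Reasoning
  n = 2 ℕ.* ℓ ℕ.+ r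
  X = qint (suc r)
  I = invS (qint (2 ℕ.* ℓ ℕ.+ suc r))
  B = qbin (2 ℕ.* ℓ ℕ.+ suc r) (+ ℓ)
  U = qpoch ℓ ⊗ qpoch (suc r ℕ.+ ℓ)
  O = oneS ⊖ qS
  P = qpoch n
  2ℓ+1+r≡1+n : 2 ℕ.* ℓ ℕ.+ suc r ≡ suc n
  2ℓ+1+r≡1+n = ℕₚ.+-suc (2 ℕ.* ℓ) r
  split : ∀ ℓ r → 2 ℕ.* ℓ ℕ.+ suc r ≡ ℓ ℕ.+ (suc r ℕ.+ ℓ)
  split = ℕ-Solver.solve-∀
  binomial : B ⊗ U ≈ P ⊗ (oneS ⊖ q^ (suc n))
  binomial = trans (≡.subst (λ N → qbin N (+ ℓ) ⊗ U ≈ qpoch N) (≡.sym (split ℓ r)) (qbin-cleared ℓ (suc r ℕ.+ ℓ)))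
                   (reflexive (cong qpoch 2ℓ+1+r≡1+n))
  inverse : I ⊗ qint (suc n) ≈ oneS
  inverse = trans (reflexive (cong (λ N → invS (qint N) ⊗ qint (suc n)) 2ℓ+1+r≡1+n))
                  (trans (*-comm (invS (qint (suc n))) (qint (suc n))) (invS-inverseʳ (constantTermOne-qint n)))

-- q-differences

binom2-suc : ∀ d → binom2 (suc d) ≡ binom2 d ℕ.+ d
binom2-suc zero    = ≡.refl
binom2-suc (suc e) = begin
  (suc (suc e) ℕ.* suc e) / 2              ≡⟨ cong (_/ 2) (expand e) ⟩
  (suc e ℕ.* e ℕ.+ suc e ℕ.* 2) / 2        ≡⟨ +-distrib-/-∣ʳ (suc e ℕ.* e) (divides (suc e) ≡.refl) ⟩
  (suc e ℕ.* e) / 2 ℕ.+ (suc e ℕ.* 2) / 2  ≡⟨ cong (binom2 (suc e) ℕ.+_) (m*n/n≡m (suc e) 2) ⟩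
  binom2 (suc e) ℕ.+ suc e                 ∎
  where
  open ≡.≡-Reasoning
  expand : ∀ e → suc (suc e) ℕ.* suc e ≡ suc e ℕ.* e ℕ.+ suc e ℕ.* 2
  expand = ℕ-Solver.solve-∀

qΔ-coeff : ℕ → ℕ → PS
qΔ-coeff m t = signS (m ∸ t) ⊗ q^ (binom2 (m ∸ t))

qΔ : ℕ → (ℕ → PS) → PS
qΔ m g = sumS (suc m) (λ t → qΔ-coeff m t ⊗ qbin m (+ t) ⊗ g t)

qΔ-coeff-suc : ∀ {m t} → t ≤ m → qΔ-coeff (suc m) t ⊗ q^ t ≈ negS (q^ m ⊗ qΔ-coeff m t)
qΔ-coeff-suc {m} {t} t≤m rewrite ℕₚ.+-∸-assoc 1 t≤m = begin
  negS s ⊗ q^ (binom2 (suc d)) ⊗ q^ t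
    ≈⟨ ⊗-congʳ (q^ t) (⊗-congˡ (negS s) (trans (reflexive (cong q^ (binom2-suc d))) (powS-+ qS (binom2 d) d))) ⟩
  negS s ⊗ (q^ (binom2 d) ⊗ q^ d) ⊗ q^ t
    ≈⟨ solve 4 (λ s B D T → (:- s) :* (B :* D) :* T := :- ((D :* T) :* (s :* B))) refl s (q^ (binom2 d)) (q^ d) (q^ t) ⟩
  negS (q^ d ⊗ q^ t ⊗ (s ⊗ q^ (binom2 d)))
    ≈⟨ -‿cong (⊗-congʳ (s ⊗ q^ (binom2 d)) (trans (sym (powS-+ qS d t)) (reflexive (cong q^ (ℕₚ.m∸n+n≡m t≤m))))) ⟩
  negS (q^ m ⊗ qΔ-coeff m t)
    ∎
  where
  open ≈-Reasoning
  d = m ∸ t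
  s = signS d

-- Split [m+1,t] by the q-Pascal rule; both halves reindex to Δ_m.
qΔ-suc : ∀ m g → qΔ (suc m) g ≈ qΔ m (λ t → g (suc t) ⊖ q^ m ⊗ g t)
qΔ-suc m g = begin
  qΔ (suc m) g                                 ≈⟨ sum-cong (suc (suc m)) (λ t _ → pascal t) ⟩
  sumS (suc (suc m)) (λ t → A t ⊕ B t)         ≈⟨ sum-+ (suc (suc m)) A B ⟩
  sumS (suc (suc m)) A ⊕ sumS (suc (suc m)) B  ≈⟨ +-cong lower upper ⟩
  sumS (suc m) A′ ⊕ sumS (suc m) B′            ≈⟨ sum-+ (suc m) A′ B′ ⟨
  sumS (suc m) (λ t → A′ t ⊕ B′ t)             ≈⟨ sum-cong (suc m) (λ t _ → collect t) ⟩
  qΔ m (λ t → g (suc t) ⊖ q^ m ⊗ g t)          ∎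
  where
  open ≈-Reasoning
  c = qΔ-coeff (suc m)
  A B A′ B′ : ℕ → PS
  A t  = c t ⊗ qbin m (ℤ.pred (+ t)) ⊗ g t
  B t  = c t ⊗ (q^ t ⊗ qbin m (+ t)) ⊗ g t
  A′ t = qΔ-coeff m t ⊗ qbin m (+ t) ⊗ g (suc t)
  B′ t = negS (q^ m ⊗ qΔ-coeff m t) ⊗ qbin m (+ t) ⊗ g t
  pascal : ∀ t → c t ⊗ qbin (suc m) (+ t) ⊗ g t ≈ A t ⊕ B t
  pascal t = trans (⊗-congʳ (g t) (⊗-congˡ (c t) (qbin-pascal m t)))
    (solve 4 (λ c P Q x → c :* (P :+ Q) :* x := c :* P :* x :+ c :* Q :* x)
             refl (c t) (qbin m (ℤ.pred (+ t))) (q^ t ⊗ qbin m (+ t)) (g t))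
  lower : sumS (suc (suc m)) A ≈ sumS (suc m) A′
  lower = begin
    sumS (suc (suc m)) A                 ≈⟨ sum-head (suc m) A ⟩
    c 0 ⊗ zeroS ⊗ g 0 ⊕ sumS (suc m) A′
      ≈⟨ ⊕-congʳ (sumS (suc m) A′) (trans (⊗-congʳ (g 0) (zeroʳ (c 0))) (zeroˡ (g 0))) ⟩
    zeroS ⊕ sumS (suc m) A′              ≈⟨ +-identityˡ _ ⟩
    sumS (suc m) A′                      ∎
  upper : sumS (suc (suc m)) B ≈ sumS (suc m) B′
  upper = begin
    sumS (suc m) B ⊕ B (suc m)  ≈⟨ +-cong (sum-cong (suc m) (λ t t≤m → shift t (ℕₚ.≤-pred t≤m))) top ⟩
    sumS (suc m) B′ ⊕ zeroS     ≈⟨ +-identityʳ _ ⟩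
    sumS (suc m) B′             ∎
    where
    shift : ∀ t → t ≤ m → B t ≈ B′ t
    shift t t≤m =
      trans (solve 4 (λ c Q G x → c :* (Q :* G) :* x := (c :* Q) :* G :* x) refl (c t) (q^ t) (qbin m (+ t)) (g t))
            (⊗-congʳ (g t) (⊗-congʳ (qbin m (+ t)) (qΔ-coeff-suc t≤m)))
    top : B (suc m) ≈ zeroS
    top rewrite qbin-> (ℕₚ.n<1+n m) =
      trans (⊗-congʳ (g (suc m)) (trans (⊗-congˡ (c (suc m)) (zeroʳ (q^ (suc m)))) (zeroʳ (c (suc m)))))
            (zeroˡ (g (suc m)))
  collect : ∀ t → A′ t ⊕ B′ t ≈ qΔ-coeff m t ⊗ qbin m (+ t) ⊗ (g (suc t) ⊖ q^ m ⊗ g t)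
  collect t = solve 5 (λ c G x Q y → c :* G :* x :+ (:- (Q :* c)) :* G :* y := c :* G :* (x :- Q :* y))
                refl (qΔ-coeff m t) (qbin m (+ t)) (g (suc t)) (q^ m) (g t)

-- QPolynomial n g: g t is a polynomial of degree < n in q^t (coefficients in PS), in Horner form.
data QPolynomial : ℕ → (ℕ → PS) → Set where
  vanishing : ∀ {g} → (∀ t → g t ≈ zeroS) → QPolynomial 0 g
  horner    : ∀ {n g} α h → QPolynomial n h → (∀ t → g t ≈ α ⊕ q^ t ⊗ h t) → QPolynomial (suc n) g

QPolynomial-resp : ∀ {n g g′} → (∀ t → g t ≈ g′ t) → QPolynomial n g → QPolynomial n g′
QPolynomial-resp g≈g′ (vanishing g≈0)   = vanishing (λ t → trans (sym (g≈g′ t)) (g≈0 t))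
QPolynomial-resp g≈g′ (horner α h P eq) = horner α h P (λ t → trans (sym (g≈g′ t)) (eq t))

QPolynomial-scale : ∀ {n h} β → QPolynomial n h → QPolynomial n (λ t → β ⊗ h t)
QPolynomial-scale β (vanishing h≈0)   = vanishing (λ t → trans (⊗-congˡ β (h≈0 t)) (zeroʳ β))
QPolynomial-scale β (horner α h P eq) = horner (β ⊗ α) (λ t → β ⊗ h t) (QPolynomial-scale β P) λ t →
  trans (⊗-congˡ β (eq t)) (solve 4 (λ b a x y → b :* (a :+ x :* y) := b :* a :+ x :* (b :* y)) refl β α (q^ t) (h t))

QPolynomial-+const : ∀ {n g} δ → QPolynomial (suc n) g → QPolynomial (suc n) (λ t → δ ⊕ g t)
QPolynomial-+const δ (horner α h P eq) =
  horner (δ ⊕ α) h P (λ t → trans (⊕-congˡ δ (eq t)) (sym (+-assoc δ α (q^ t ⊗ h t))))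

QPolynomial-*linear : ∀ {n g} β γ → QPolynomial n g → QPolynomial (suc n) (λ t → (β ⊕ γ ⊗ q^ t) ⊗ g t)
QPolynomial-*linear β γ (vanishing g≈0) = horner zeroS (λ _ → zeroS) (vanishing (λ _ → refl)) λ t →
  trans (⊗-congˡ (β ⊕ γ ⊗ q^ t) (g≈0 t))
        (solve 3 (λ b c x → (b :+ c :* x) :* con (+ 0) := con (+ 0) :+ x :* con (+ 0)) refl β γ (q^ t))
QPolynomial-*linear β γ (horner α h P eq) =
  horner (β ⊗ α) (λ t → γ ⊗ α ⊕ (β ⊕ γ ⊗ q^ t) ⊗ h t)
         (QPolynomial-+const (γ ⊗ α) (QPolynomial-*linear β γ P)) λ t →
    trans (⊗-congˡ (β ⊕ γ ⊗ q^ t) (eq t))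
          (solve 5 (λ b c x a y → (b :+ c :* x) :* (a :+ x :* y) := b :* a :+ x :* (c :* a :+ (b :+ c :* x) :* y))
                   refl β γ (q^ t) α (h t))

-- g(t+1) - q^n g(t) kills the top coefficient: the term α q^{et} becomes α q^{et} (q^e - q^n).
QPolynomial-shift : ∀ {n g} → QPolynomial (suc n) g → QPolynomial n (λ t → g (suc t) ⊖ q^ n ⊗ g t)
QPolynomial-shift {zero} {g} (horner α h (vanishing h≈0) eq) = vanishing λ t → begin
  g (suc t) ⊖ oneS ⊗ g t
    ≈⟨ +-cong (eq (suc t)) (-‿cong (⊗-congˡ oneS (eq t))) ⟩
  α ⊕ q^ t ⊗ qS ⊗ h (suc t) ⊖ oneS ⊗ (α ⊕ q^ t ⊗ h t)
    ≈⟨ +-cong (⊕-congˡ α (⊗-congˡ (q^ t ⊗ qS) (h≈0 (suc t))))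
              (-‿cong (⊗-congˡ oneS (⊕-congˡ α (⊗-congˡ (q^ t) (h≈0 t))))) ⟩
  α ⊕ q^ t ⊗ qS ⊗ zeroS ⊖ oneS ⊗ (α ⊕ q^ t ⊗ zeroS)
    ≈⟨ solve 3 (λ a x q → a :+ x :* q :* con (+ 0) :- con (+ 1) :* (a :+ x :* con (+ 0)) := con (+ 0)) refl α (q^ t) qS ⟩
  zeroS
    ∎
  where open ≈-Reasoning
QPolynomial-shift {suc n} {g} (horner α h P eq) =
  horner (α ⊗ (oneS ⊖ q^ (suc n))) (λ t → qS ⊗ (h (suc t) ⊖ q^ n ⊗ h t))
         (QPolynomial-scale qS (QPolynomial-shift P)) λ t →
    begin
    g (suc t) ⊖ q^ (suc n) ⊗ g t
      ≈⟨ +-cong (eq (suc t)) (-‿cong (⊗-congˡ (q^ (suc n)) (eq t))) ⟩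
    α ⊕ q^ t ⊗ qS ⊗ h (suc t) ⊖ q^ n ⊗ qS ⊗ (α ⊕ q^ t ⊗ h t)
      ≈⟨ solve 6 (λ a x q y Q z → a :+ x :* q :* y :- Q :* q :* (a :+ x :* z)
                                   := a :* (con (+ 1) :- Q :* q) :+ x :* (q :* (y :- Q :* z)))
                 refl α (q^ t) qS (h (suc t)) (q^ n) (h t) ⟩
    α ⊗ (oneS ⊖ q^ (suc n)) ⊕ q^ t ⊗ (qS ⊗ (h (suc t) ⊖ q^ n ⊗ h t))
      ∎
  where open ≈-Reasoning

qΔ-annihilates : ∀ m {g} → QPolynomial m g → qΔ m g ≈ zeroS
qΔ-annihilates zero {g} (vanishing g≈0) = begin
  zeroS ⊕ c ⊗ g 0  ≈⟨ ⊕-congˡ zeroS (trans (⊗-congˡ c (g≈0 0)) (zeroʳ c)) ⟩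
  zeroS ⊕ zeroS    ≈⟨ +-identityˡ zeroS ⟩
  zeroS            ∎
  where
  open ≈-Reasoning
  c = qΔ-coeff 0 0 ⊗ qbin 0 (+ 0)
qΔ-annihilates (suc m) {g} P = trans (qΔ-suc m g) (qΔ-annihilates m (QPolynomial-shift P))

qpochFrom-QPolynomial : ∀ a s → QPolynomial (suc s) (λ t → qpochFrom (a ℕ.+ t) s)
qpochFrom-QPolynomial a zero = horner oneS (λ _ → zeroS) (vanishing (λ _ → refl)) λ t →
  sym (trans (⊕-congˡ oneS (zeroʳ (q^ t))) (+-identityʳ oneS))
qpochFrom-QPolynomial a (suc s) =
  QPolynomial-resp factor (QPolynomial-*linear oneS (negS Q) (qpochFrom-QPolynomial a s))
  where
  open ≈-Reasoning
  Q = q^ (a ℕ.+ suc s)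
  factor : ∀ t → (oneS ⊕ negS Q ⊗ q^ t) ⊗ qpochFrom (a ℕ.+ t) s ≈ qpochFrom (a ℕ.+ t) (suc s)
  factor t = begin
    (oneS ⊕ negS Q ⊗ q^ t) ⊗ R
      ≈⟨ solve 3 (λ Q T R → (con (+ 1) :+ (:- Q) :* T) :* R := R :* (con (+ 1) :- Q :* T)) refl Q (q^ t) R ⟩
    R ⊗ (oneS ⊖ Q ⊗ q^ t)                ≈⟨ ⊗-congˡ R (⊕-congˡ oneS (-‿cong (sym (powS-+ qS (a ℕ.+ suc s) t)))) ⟩
    R ⊗ (oneS ⊖ q^ (a ℕ.+ suc s ℕ.+ t))  ≡⟨ cong (λ n → R ⊗ (oneS ⊖ q^ n)) (reorder a s t) ⟩
    R ⊗ (oneS ⊖ q^ (a ℕ.+ t ℕ.+ suc s))  ∎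
    where
    R = qpochFrom (a ℕ.+ t) s
    reorder : ∀ a s t → a ℕ.+ suc s ℕ.+ t ≡ a ℕ.+ t ℕ.+ suc s
    reorder = ℕ-Solver.solve-∀

-- Lower triangular matrices

infix 4 _≈ᴹ_
_≈ᴹ_ : Mat → Mat → Set
A ≈ᴹ B = ∀ i k → A i k ≈ B i k

LowerTriangular : Mat → Set
LowerTriangular A = ∀ {i j} → i < j → A i j ≈ zeroS

UnitDiagonal : Mat → Set
UnitDiagonal A = ∀ i → A i i ≈ oneS

IdMat-diag : ∀ i → IdMat i i ≡ oneS
IdMat-diag i with i ≟ i
... | yes _  = ≡.refl
... | no i≢i = ⊥-elim (i≢i ≡.refl)

IdMat-≢ : ∀ {i k} → i ≢ k → IdMat i k ≡ zeroS
IdMat-≢ {i} {k} i≢k with i ≟ k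
... | yes i≡k = ⊥-elim (i≢k i≡k)
... | no _    = ≡.refl

IdMat-lower : LowerTriangular IdMat
IdMat-lower i<j = reflexive (IdMat-≢ (ℕₚ.<⇒≢ i<j))

⊙-prefix : ∀ (A B : Mat) → LowerTriangular B → ∀ n i k → n ≤ k → sumS n (λ j → A i j ⊗ B j k) ≈ zeroS
⊙-prefix A B lower n i k n≤k =
  sum-zeros n (λ j j<n → trans (⊗-congˡ (A i j) (lower (ℕₚ.<-≤-trans j<n n≤k))) (zeroʳ (A i j)))

⊙-upper : ∀ (A B : Mat) → LowerTriangular B → ∀ {i k} → i < k → (A ⊙ B) i k ≈ zeroS
⊙-upper A B lower {i} {k} = ⊙-prefix A B lower (suc i) i k

⊙-diag : ∀ (A B : Mat) → LowerTriangular B → ∀ i → (A ⊙ B) i i ≈ A i i ⊗ B i i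
⊙-diag A B lower i =
  trans (⊕-congʳ (A i i ⊗ B i i) (⊙-prefix A B lower i i i ℕₚ.≤-refl)) (+-identityˡ (A i i ⊗ B i i))

⊙-congˡ : ∀ {A A′} (C : Mat) → A ≈ᴹ A′ → A ⊙ C ≈ᴹ A′ ⊙ C
⊙-congˡ C A≈A′ i k = sum-cong (suc i) (λ j _ → ⊗-congʳ (C j k) (A≈A′ i j))

sum-extend : ∀ {j i} (F : ℕ → PS) → j ≤ i → (∀ l → j < l → F l ≈ zeroS) → sumS (suc j) F ≈ sumS (suc i) F
sum-extend {j} {i} F j≤i tail = begin
  sumS (suc j) F                                      ≈⟨ +-identityʳ _ ⟨
  sumS (suc j) F ⊕ zeroS                              ≈⟨ ⊕-congˡ (sumS (suc j) F) (sum-zeros (i ∸ j) beyond) ⟨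
  sumS (suc j) F ⊕ sumS (i ∸ j) (λ l → F (suc j ℕ.+ l))  ≈⟨ sum-split (suc j) (i ∸ j) F ⟨
  sumS (suc j ℕ.+ (i ∸ j)) F                          ≡⟨ cong (λ n → sumS (suc n) F) (ℕₚ.m+[n∸m]≡n j≤i) ⟩
  sumS (suc i) F                                      ∎
  where
  open ≈-Reasoning
  beyond : ∀ l → l < i ∸ j → F (suc j ℕ.+ l) ≈ zeroS
  beyond l _ = tail (suc j ℕ.+ l) (s≤s (ℕₚ.m≤m+n j l))

-- _⊙_ only sums over j ≤ i, so associativity needs the middle factor to be lower triangular.
⊙-assoc : ∀ (A B C : Mat) → LowerTriangular B → A ⊙ (B ⊙ C) ≈ᴹ (A ⊙ B) ⊙ C
⊙-assoc A B C lower i k = begin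
  sumS (suc i) (λ j → A i j ⊗ sumS (suc j) (λ l → B j l ⊗ C l k))    ≈⟨ sum-cong (suc i) extend ⟩
  sumS (suc i) (λ j → sumS (suc i) (λ l → A i j ⊗ (B j l ⊗ C l k)))  ≈⟨ sum-swap (suc i) (suc i) _ ⟩
  sumS (suc i) (λ l → sumS (suc i) (λ j → A i j ⊗ (B j l ⊗ C l k)))  ≈⟨ sum-cong (suc i) regroup ⟩
  sumS (suc i) (λ l → sumS (suc i) (λ j → A i j ⊗ B j l) ⊗ C l k)    ∎
  where
  open ≈-Reasoning
  vanish : ∀ j l → j < l → A i j ⊗ (B j l ⊗ C l k) ≈ zeroS
  vanish j l j<l = trans (⊗-congˡ (A i j) (trans (⊗-congʳ (C l k) (lower j<l)) (zeroˡ (C l k)))) (zeroʳ (A i j))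
  extend : ∀ j → j < suc i →
           A i j ⊗ sumS (suc j) (λ l → B j l ⊗ C l k) ≈ sumS (suc i) (λ l → A i j ⊗ (B j l ⊗ C l k))
  extend j j≤i = trans (sum-*ˡ (suc j) (A i j) _) (sum-extend _ (ℕₚ.≤-pred j≤i) (vanish j))
  regroup : ∀ l → l < suc i →
            sumS (suc i) (λ j → A i j ⊗ (B j l ⊗ C l k)) ≈ sumS (suc i) (λ j → A i j ⊗ B j l) ⊗ C l k
  regroup l _ = trans (sum-cong (suc i) (λ j _ → sym (*-assoc (A i j) (B j l) (C l k))))
                      (sym (sum-*ʳ (suc i) (C l k) _))

⊙-identityˡ : ∀ (C : Mat) → IdMat ⊙ C ≈ᴹ C
⊙-identityˡ C i k = begin
  sumS i (λ j → IdMat i j ⊗ C j k) ⊕ IdMat i i ⊗ C i k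
    ≈⟨ +-cong (sum-zeros i offDiagonal) (reflexive (cong (_⊗ C i k) (IdMat-diag i))) ⟩
  zeroS ⊕ oneS ⊗ C i k
    ≈⟨ trans (+-identityˡ _) (*-identityˡ (C i k)) ⟩
  C i k
    ∎
  where
  open ≈-Reasoning
  offDiagonal : ∀ j → j < i → IdMat i j ⊗ C j k ≈ zeroS
  offDiagonal j j<i = trans (⊗-congʳ (C j k) (reflexive (IdMat-≢ (ℕₚ.>⇒≢ j<i)))) (zeroˡ (C j k))

sum-select : ∀ n (F : ℕ → PS) k → k < n → sumS n (λ j → F j ⊗ IdMat j k) ≈ F k
sum-select (suc n) F k k≤n with ℕₚ.m≤n⇒m<n∨m≡n (ℕₚ.≤-pred k≤n)
... | inj₁ k<n = begin
  sumS n (λ j → F j ⊗ IdMat j k) ⊕ F n ⊗ IdMat n k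
    ≈⟨ +-cong (sum-select n F k k<n) (⊗-congˡ (F n) (reflexive (IdMat-≢ (ℕₚ.>⇒≢ k<n)))) ⟩
  F k ⊕ F n ⊗ zeroS
    ≈⟨ trans (⊕-congˡ (F k) (zeroʳ (F n))) (+-identityʳ (F k)) ⟩
  F k
    ∎
  where open ≈-Reasoning
... | inj₂ ≡.refl = begin
  sumS k (λ j → F j ⊗ IdMat j k) ⊕ F k ⊗ IdMat k k
    ≈⟨ +-cong (⊙-prefix (λ _ → F) IdMat IdMat-lower k 0 k ℕₚ.≤-refl) (⊗-congˡ (F k) (reflexive (IdMat-diag k))) ⟩
  zeroS ⊕ F k ⊗ oneS
    ≈⟨ trans (+-identityˡ _) (*-identityʳ (F k)) ⟩
  F k
    ∎
  where open ≈-Reasoning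

⊙-identityʳ : ∀ A → LowerTriangular A → A ⊙ IdMat ≈ᴹ A
⊙-identityʳ A lower i k with ℕₚ.<-cmp i k
... | tri< i<k _ _    = trans (⊙-upper A IdMat IdMat-lower i<k) (sym (lower i<k))
... | tri≈ _ ≡.refl _ = sum-select (suc i) (A i) i ℕₚ.≤-refl
... | tri> _ _ k<i    = sum-select (suc i) (A i) k (ℕₚ.m<n⇒m<1+n k<i)

-- Forward substitution: row i of X is determined by the rows above it.
unitriangular-cancel : ∀ A X → LowerTriangular A → UnitDiagonal A → A ⊙ X ≈ᴹ A → X ≈ᴹ IdMat
unitriangular-cancel A X lower unit AX≈A = <-rec _ row
  where
  row : ∀ i → (∀ {j} → j < i → ∀ k → X j k ≈ IdMat j k) → ∀ k → X i k ≈ IdMat i k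
  row i above k = ∙-cancelˡ S (X i k) (IdMat i k) (begin
    S ⊕ X i k              ≈⟨ +-cong (sum-cong i (λ j j<i → ⊗-congˡ (A i j) (sym (above j<i k)))) (sym (diagonal (X i k))) ⟩
    (A ⊙ X) i k            ≈⟨ AX≈A i k ⟩
    A i k                  ≈⟨ ⊙-identityʳ A lower i k ⟨
    S ⊕ A i i ⊗ IdMat i k  ≈⟨ ⊕-congˡ S (diagonal (IdMat i k)) ⟩
    S ⊕ IdMat i k          ∎)
    where
    open ≈-Reasoning
    S = sumS i (λ j → A i j ⊗ IdMat j k)
    diagonal : ∀ x → A i i ⊗ x ≈ x
    diagonal x = trans (⊗-congʳ x (unit i)) (*-identityˡ x)

-- For triangular matrices a one-sided inverse is two-sided: A (B A) = (A B) A = A.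
leftInverse⇒rightInverse : ∀ A B → LowerTriangular A → UnitDiagonal A → LowerTriangular B →
                           A ⊙ B ≈ᴹ IdMat → B ⊙ A ≈ᴹ IdMat
leftInverse⇒rightInverse A B lowerA unitA lowerB AB≈I = unitriangular-cancel A (B ⊙ A) lowerA unitA
  (λ i k → trans (⊙-assoc A B A lowerB i k) (trans (⊙-congˡ A AB≈I i k) (⊙-identityˡ A i k)))

-- The matrices P and Q

Pmat-≤ : ∀ {i j} → j ≤ i → Pmat i j ≡ signS (i ∸ j) ⊗ q^ (binom2 (i ∸ j)) ⊗ qbin (i ℕ.+ j) (+ (i ∸ j))
Pmat-≤ {i} {j} j≤i with j ≤? i
... | yes _   = ≡.refl
... | no j≰i = ⊥-elim (j≰i j≤i)

Pmat-lower : LowerTriangular Pmat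
Pmat-lower {i} {j} i<j with j ≤? i
... | yes j≤i = ⊥-elim (ℕₚ.<⇒≱ i<j j≤i)
... | no _    = refl

Pmat-below : ∀ j d → Pmat (j ℕ.+ d) j ≡ signS d ⊗ q^ (binom2 d) ⊗ qbin (d ℕ.+ (j ℕ.+ j)) (+ d)
Pmat-below j d = ≡.trans (Pmat-≤ (ℕₚ.m≤m+n j d))
  (cong₂ (λ e n → signS e ⊗ q^ (binom2 e) ⊗ qbin n (+ e)) (ℕₚ.m+n∸m≡n j d) (reorder j d))
  where
  reorder : ∀ j d → j ℕ.+ d ℕ.+ j ≡ d ℕ.+ (j ℕ.+ j)
  reorder = ℕ-Solver.solve-∀

Pmat-diag : UnitDiagonal Pmat
Pmat-diag i = begin
  Pmat i i                            ≡⟨ cong (λ n → Pmat n i) (ℕₚ.+-identityʳ i) ⟨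
  Pmat (i ℕ.+ 0) i                    ≡⟨ Pmat-below i 0 ⟩
  oneS ⊗ oneS ⊗ qbin (i ℕ.+ i) (+ 0)  ≈⟨ *-cong (*-identityˡ oneS) (qbin-zero (i ℕ.+ i)) ⟩
  oneS ⊗ oneS                         ≈⟨ *-identityˡ oneS ⟩
  oneS                                ∎
  where open ≈-Reasoning

Qmat-lower : LowerTriangular Qmat
Qmat-lower {j} {k} j<k with ℕₚ.m≤n⇒∃[o]m+o≡n j<k
... | x , ≡.refl = reflexive (cong (λ c → Cq c (2 ℕ.* suc (j ℕ.+ x) ℕ.+ 1)) difference)
  where
  ⊖-suc-+ : ∀ j → j ℤ.⊖ suc (j ℕ.+ x) ≡ -[1+ x ]
  ⊖-suc-+ zero    = ≡.refl
  ⊖-suc-+ (suc j) = ≡.trans (ℤₚ.[1+m]⊖[1+n]≡m⊖n j (suc (j ℕ.+ x))) (⊖-suc-+ j)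
  difference : + j ℤ.- + suc (j ℕ.+ x) ≡ -[1+ x ]
  difference = ≡.trans (ℤₚ.[+m]-[+n]≡m⊖n j (suc (j ℕ.+ x))) (⊖-suc-+ j)

Qmat-below : ∀ k t → Qmat (k ℕ.+ t) k ≡ Cq (+ t) (suc (2 ℕ.* k))
Qmat-below k t = cong₂ Cq difference (ℕₚ.+-comm (2 ℕ.* k) 1)
  where
  difference : + (k ℕ.+ t) ℤ.- + k ≡ + t
  difference = ≡.trans (ℤₚ.[+m]-[+n]≡m⊖n (k ℕ.+ t) k)
                       (≡.trans (ℤₚ.⊖-≥ (ℕₚ.m≤m+n k t)) (cong +_ (ℕₚ.m+n∸m≡n k t)))

Qmat-diag : UnitDiagonal Qmat
Qmat-diag k = begin
  Qmat k k                             ≡⟨ cong (λ i → Qmat i k) (ℕₚ.+-identityʳ k) ⟨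
  Qmat (k ℕ.+ 0) k                     ≡⟨ Qmat-below k 0 ⟩
  X ⊗ invS X ⊗ qbin (suc (2 ℕ.* k)) (+ 0)
    ≈⟨ *-cong (invS-inverseʳ (constantTermOne-qint (2 ℕ.* k))) (qbin-zero (suc (2 ℕ.* k))) ⟩
  oneS ⊗ oneS                          ≈⟨ *-identityˡ oneS ⟩
  oneS                                 ∎
  where
  open ≈-Reasoning
  X = qint (suc (2 ℕ.* k))

-- Here m = t + d = m′ + 1. All denominators clear against (q;q)_d (q;q)_{2j} (q;q)_t (q;q)_{2k+1+t},
-- and what is left of (q;q)_{d+2j} / (q;q)_{2k+1+t} is (q^{2k+t+2};q)_{m′}, a polynomial in q^t.
PQ-term : ∀ k t d m′ → t ℕ.+ d ≡ suc m′ → let j = k ℕ.+ t in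
  Pmat (j ℕ.+ d) j ⊗ Qmat j k ⊗ qpoch (t ℕ.+ d)
  ≈ (oneS ⊖ q^ (suc (2 ℕ.* k)))
    ⊗ (signS d ⊗ q^ (binom2 d) ⊗ qbin (t ℕ.+ d) (+ t) ⊗ qpochFrom (suc (2 ℕ.* k) ℕ.+ t) m′)
PQ-term k t d m′ t+d≡1+m′ = cancelʳ unitU (begin
  P ⊗ Q ⊗ M ⊗ (Uᴾ ⊗ Uᵠ)       ≈⟨ xy∙z≈xz∙y (P ⊗ Q) M (Uᴾ ⊗ Uᵠ) ⟩
  P ⊗ Q ⊗ (Uᴾ ⊗ Uᵠ) ⊗ M       ≈⟨ ⊗-congʳ M (interchange P Q Uᴾ Uᵠ) ⟩
  P ⊗ Uᴾ ⊗ (Q ⊗ Uᵠ) ⊗ M       ≈⟨ ⊗-congʳ M (*-cong P-cleared Q-cleared) ⟩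
  c ⊗ qpoch N ⊗ (E ⊗ P₂) ⊗ M
    ≈⟨ solve 5 (λ c N E P₂ M → c :* N :* (E :* P₂) :* M := E :* c :* M :* N :* P₂) refl c (qpoch N) E P₂ M ⟩
  E ⊗ c ⊗ M ⊗ qpoch N ⊗ P₂
    ≈⟨ ⊗-congʳ P₂ (*-cong (⊗-congˡ (E ⊗ c) G-cleared) R-cleared) ⟨
  E ⊗ c ⊗ (G ⊗ (qpoch t ⊗ qpoch d)) ⊗ (qpoch a ⊗ R) ⊗ P₂
    ≈⟨ solve 8 (λ E c G R Pd P₂ Pt Pa → E :* (c :* G :* R) :* (Pd :* P₂ :* (Pt :* Pa))
                                         := E :* c :* (G :* (Pt :* Pd)) :* (Pa :* R) :* P₂)
               refl E c G R (qpoch d) P₂ (qpoch t) (qpoch a) ⟨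
  E ⊗ (c ⊗ G ⊗ R) ⊗ (Uᴾ ⊗ Uᵠ)
    ∎)
  where
  open ≈-Reasoning
  j = k ℕ.+ t
  a = suc (2 ℕ.* k) ℕ.+ t
  N = d ℕ.+ (j ℕ.+ j)
  c = signS d ⊗ q^ (binom2 d)
  E = oneS ⊖ q^ (suc (2 ℕ.* k))
  P = Pmat (j ℕ.+ d) j
  Q = Qmat j k
  M = qpoch (t ℕ.+ d)
  G = qbin (t ℕ.+ d) (+ t)
  R = qpochFrom a m′
  P₂ = qpoch (j ℕ.+ j)
  Uᴾ = qpoch d ⊗ P₂
  Uᵠ = qpoch t ⊗ qpoch a
  unitU : ConstantTermOne (Uᴾ ⊗ Uᵠ)
  unitU = ⊗-constantTermOne (⊗-constantTermOne (constantTermOne-qpoch d) (constantTermOne-qpoch (j ℕ.+ j)))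
                            (⊗-constantTermOne (constantTermOne-qpoch t) (constantTermOne-qpoch a))
  P-cleared : P ⊗ Uᴾ ≈ c ⊗ qpoch N
  P-cleared = begin
    P ⊗ Uᴾ                   ≡⟨ cong (_⊗ Uᴾ) (Pmat-below j d) ⟩
    c ⊗ qbin N (+ d) ⊗ Uᴾ    ≈⟨ *-assoc c (qbin N (+ d)) Uᴾ ⟩
    c ⊗ (qbin N (+ d) ⊗ Uᴾ)  ≈⟨ ⊗-congˡ c (qbin-cleared d (j ℕ.+ j)) ⟩
    c ⊗ qpoch N              ∎
  Q-cleared : Q ⊗ Uᵠ ≈ E ⊗ P₂
  Q-cleared = begin
    Q ⊗ Uᵠ                           ≡⟨ cong (_⊗ Uᵠ) (Qmat-below k t) ⟩
    Cq (+ t) (suc (2 ℕ.* k)) ⊗ Uᵠ    ≈⟨ Cq-cleared t (2 ℕ.* k) ⟩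
    E ⊗ qpoch (2 ℕ.* t ℕ.+ 2 ℕ.* k)  ≡⟨ cong (λ n → E ⊗ qpoch n) (double k t) ⟩
    E ⊗ P₂                           ∎
    where
    double : ∀ k t → 2 ℕ.* t ℕ.+ 2 ℕ.* k ≡ k ℕ.+ t ℕ.+ (k ℕ.+ t)
    double = ℕ-Solver.solve-∀
  G-cleared : G ⊗ (qpoch t ⊗ qpoch d) ≈ M
  G-cleared = qbin-cleared t d
  R-cleared : qpoch a ⊗ R ≈ qpoch N
  R-cleared = trans (sym (qpoch-+ a m′)) (reflexive (cong qpoch a+m′≡N))
    where
    shuffle : ∀ k t m′ → suc (2 ℕ.* k) ℕ.+ t ℕ.+ m′ ≡ 2 ℕ.* k ℕ.+ t ℕ.+ suc m′
    shuffle = ℕ-Solver.solve-∀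
    collect : ∀ k t d → 2 ℕ.* k ℕ.+ t ℕ.+ (t ℕ.+ d) ≡ d ℕ.+ (k ℕ.+ t ℕ.+ (k ℕ.+ t))
    collect = ℕ-Solver.solve-∀
    a+m′≡N : a ℕ.+ m′ ≡ N
    a+m′≡N = ≡.trans (shuffle k t m′) (≡.trans (cong (2 ℕ.* k ℕ.+ t ℕ.+_) (≡.sym t+d≡1+m′)) (collect k t d))

PQ-below : ∀ k m′ → (Pmat ⊙ Qmat) (k ℕ.+ suc m′) k ≈ zeroS
PQ-below k m′ = cancelʳ (constantTermOne-qpoch m) (begin
  sumS (suc (k ℕ.+ m)) F ⊗ qpoch m              ≡⟨ cong (λ n → sumS n F ⊗ qpoch m) (ℕₚ.+-suc k m) ⟨
  sumS (k ℕ.+ suc m) F ⊗ qpoch m                ≈⟨ ⊗-congʳ (qpoch m) (sum-split k (suc m) F) ⟩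
  (sumS k F ⊕ sumS (suc m) F′) ⊗ qpoch m        ≈⟨ ⊗-congʳ (qpoch m) (⊕-congʳ (sumS (suc m) F′) left) ⟩
  (zeroS ⊕ sumS (suc m) F′) ⊗ qpoch m           ≈⟨ ⊗-congʳ (qpoch m) (+-identityˡ (sumS (suc m) F′)) ⟩
  sumS (suc m) F′ ⊗ qpoch m                     ≈⟨ sum-*ʳ (suc m) (qpoch m) F′ ⟩
  sumS (suc m) (λ t → F′ t ⊗ qpoch m)           ≈⟨ sum-cong (suc m) term ⟩
  sumS (suc m) (λ t → E ⊗ (qΔ-coeff m t ⊗ qbin m (+ t) ⊗ R t))
                                                ≈⟨ sum-*ˡ (suc m) E _ ⟨
  E ⊗ qΔ m R                                    ≈⟨ ⊗-congˡ E (qΔ-annihilates m polynomial) ⟩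
  E ⊗ zeroS                                     ≈⟨ zeroʳ E ⟩
  zeroS                                         ≈⟨ zeroˡ (qpoch m) ⟨
  zeroS ⊗ qpoch m                               ∎)
  where
  open ≈-Reasoning
  m = suc m′
  E = oneS ⊖ q^ (suc (2 ℕ.* k))
  F F′ R : ℕ → PS
  F j  = Pmat (k ℕ.+ m) j ⊗ Qmat j k
  F′ t = F (k ℕ.+ t)
  R t  = qpochFrom (suc (2 ℕ.* k) ℕ.+ t) m′
  polynomial : QPolynomial m R
  polynomial = qpochFrom-QPolynomial (suc (2 ℕ.* k)) m′
  left : sumS k F ≈ zeroS
  left = ⊙-prefix Pmat Qmat Qmat-lower k (k ℕ.+ m) k ℕₚ.≤-refl
  term : ∀ t → t < suc m → F′ t ⊗ qpoch m ≈ E ⊗ (qΔ-coeff m t ⊗ qbin m (+ t) ⊗ R t)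
  term t t<1+m with ℕₚ.m≤n⇒∃[o]m+o≡n (ℕₚ.≤-pred t<1+m)
  ... | d , t+d≡m = begin
    F′ t ⊗ qpoch m
      ≡⟨ cong (λ n → Pmat (k ℕ.+ n) (k ℕ.+ t) ⊗ Qmat (k ℕ.+ t) k ⊗ qpoch n) t+d≡m ⟨
    Pmat (k ℕ.+ (t ℕ.+ d)) (k ℕ.+ t) ⊗ Qmat (k ℕ.+ t) k ⊗ qpoch (t ℕ.+ d)
      ≡⟨ cong (λ i → Pmat i (k ℕ.+ t) ⊗ Qmat (k ℕ.+ t) k ⊗ qpoch (t ℕ.+ d)) (ℕₚ.+-assoc k t d) ⟨
    Pmat (k ℕ.+ t ℕ.+ d) (k ℕ.+ t) ⊗ Qmat (k ℕ.+ t) k ⊗ qpoch (t ℕ.+ d)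
      ≈⟨ PQ-term k t d m′ t+d≡m ⟩
    E ⊗ (signS d ⊗ q^ (binom2 d) ⊗ qbin (t ℕ.+ d) (+ t) ⊗ R t)
      ≡⟨ cong (λ n → E ⊗ (signS n ⊗ q^ (binom2 n) ⊗ qbin (t ℕ.+ d) (+ t) ⊗ R t)) (ℕₚ.m+n∸m≡n t d) ⟨
    E ⊗ (qΔ-coeff (t ℕ.+ d) t ⊗ qbin (t ℕ.+ d) (+ t) ⊗ R t)
      ≡⟨ cong (λ n → E ⊗ (qΔ-coeff n t ⊗ qbin n (+ t) ⊗ R t)) t+d≡m ⟩
    E ⊗ (qΔ-coeff m t ⊗ qbin m (+ t) ⊗ R t)
      ∎

PQ≈Id : Pmat ⊙ Qmat ≈ᴹ IdMat
PQ≈Id i k with ℕₚ.<-cmp i k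
... | tri< i<k _ _ = trans (⊙-upper Pmat Qmat Qmat-lower i<k) (sym (IdMat-lower i<k))
... | tri≈ _ ≡.refl _ = begin
  (Pmat ⊙ Qmat) i i    ≈⟨ ⊙-diag Pmat Qmat Qmat-lower i ⟩
  Pmat i i ⊗ Qmat i i  ≈⟨ *-cong (Pmat-diag i) (Qmat-diag i) ⟩
  oneS ⊗ oneS          ≈⟨ *-identityˡ oneS ⟩
  oneS                 ≡⟨ IdMat-diag i ⟨
  IdMat i i            ∎
  where open ≈-Reasoning
... | tri> _ i≢k k<i with ℕₚ.m≤n⇒∃[o]m+o≡n k<i
...   | m′ , ≡.refl = begin
  (Pmat ⊙ Qmat) (suc k ℕ.+ m′) k  ≡⟨ cong (λ i → (Pmat ⊙ Qmat) i k) (ℕₚ.+-suc k m′) ⟨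
  (Pmat ⊙ Qmat) (k ℕ.+ suc m′) k  ≈⟨ PQ-below k m′ ⟩
  zeroS                           ≡⟨ IdMat-≢ i≢k ⟨
  IdMat (suc k ℕ.+ m′) k          ∎
  where open ≈-Reasoning

mainTheorem15 : (∀ i k → (Pmat ⊙ Qmat) i k ≋ IdMat i k) × (∀ i k → (Qmat ⊙ Pmat) i k ≋ IdMat i k)
mainTheorem15 = (λ i k → unwrap (PQ≈Id i k)) , (λ i k → unwrap (QP≈Id i k))
  where
  QP≈Id : Qmat ⊙ Pmat ≈ᴹ IdMat
  QP≈Id = leftInverse⇒rightInverse Pmat Qmat Pmat-lower Pmat-diag Qmat-lower PQ≈Id
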